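{- Let $G$ be a triangle-free graph that is gap-critical. Then every connected component of $G$ is factor-critical.
   Context: All graphs are finite and simple. $\theta(G)$ is the minimum number of cliques covering $V(G)$, $\alpha(G)$ the maximum size of a stable set, and $\mathrm{gap}(G)=\theta(G)-\alpha(G)$. A graph $G$ is gap-critical if for every vertex $v$ of $G$, $\mathrm{gap}(G\setminus v)<\mathrm{gap}(G)$. A graph is factor-critical if deleting any one of its vertices yields a graph with a perfect matching. -}

module Defs where

open import Data.Nat using (ℕ; _+_; _<_; _≤_)
open import Data.Bool using (Bool; true; false)
open import Data.Fin using (Fin)
open import Data.Fin.Subset using (Subset; _∈_; _∉_; _⊆_; _-_; ∣_∣; ⊤)
open import Data.List using (List; length)
open import Data.List.Relation.Unary.All using (All)
open import Data.List.Relation.Unary.Any using (Any)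
open import Data.Product using (Σ; ∃; _×_; _,_)
open import Relation.Binary.PropositionalEquality using (_≡_; _≢_)
open import Relation.Nullary using (¬_)

record Graph (n : ℕ) : Set where
  field
    adj   : Fin n → Fin n → Bool
    sym   : ∀ u v → adj u v ≡ adj v u
    irrefl : ∀ u → adj u u ≡ false

open Graph public

module _ {n : ℕ} (G : Graph n) where

  Adj : Fin n → Fin n → Set
  Adj u v = adj G u v ≡ true

  -- All graphs below are induced subgraphs G[W] for a vertex set W : Subset n.

  IsClique : Subset n → Subset n → Set
  IsClique W K = K ⊆ W × (∀ u v → u ∈ K → v ∈ K → u ≢ v → Adj u v)

  IsStable : Subset n → Subset n → Set
  IsStable W S = S ⊆ W × (∀ u v → u ∈ S → v ∈ S → ¬ Adj u v)

  IsCliqueCover : Subset n → List (Subset n) → Set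
  IsCliqueCover W Ks = All (IsClique W) Ks × (∀ u → u ∈ W → Any (u ∈_) Ks)

  IsAlpha : Subset n → ℕ → Set
  IsAlpha W k = (∃ λ S → IsStable W S × ∣ S ∣ ≡ k)
              × (∀ S → IsStable W S → ∣ S ∣ ≤ k)

  IsTheta : Subset n → ℕ → Set
  IsTheta W k = (∃ λ Ks → IsCliqueCover W Ks × length Ks ≡ k)
              × (∀ Ks → IsCliqueCover W Ks → k ≤ length Ks)

  -- G[W] is gap-critical: for every vertex v of W,
  -- gap(G[W] \ v) < gap(G[W]), i.e. θ' - α' < θ - α, written without
  -- subtraction as θ' + α < θ + α'.
  GapCritical : Subset n → Set
  GapCritical W = ∀ v → v ∈ W → ∀ a t a' t' →
    IsAlpha W a → IsTheta W t → IsAlpha (W - v) a' → IsTheta (W - v) t' →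
    t' + a < t + a'

  TriangleFree : Subset n → Set
  TriangleFree W = ∀ a b c → a ∈ W → b ∈ W → c ∈ W →
    ¬ (Adj a b × Adj b c × Adj a c)

  data Reach (C : Subset n) : Fin n → Fin n → Set where
    here : ∀ {u} → u ∈ C → Reach C u u
    step : ∀ {u v w} → u ∈ C → Adj u v → Reach C v w → Reach C u w

  IsComponent : Subset n → Subset n → Set
  IsComponent W C = (∃ λ u → u ∈ C) × C ⊆ W
    × (∀ u w → u ∈ C → w ∈ C → Reach C u w)
    × (∀ u w → u ∈ C → w ∈ W → Adj u w → w ∈ C)

  HasPerfectMatching : Subset n → Set
  HasPerfectMatching U = Σ (Fin n → Fin n) λ M →
    ∀ u → u ∈ U → (M u ∈ U) × Adj u (M u) × (M (M u) ≡ u)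

  FactorCritical : Subset n → Set
  FactorCritical C = ∀ v → v ∈ C → HasPerfectMatching (C - v)

-- In a triangle-free graph a clique has at most two vertices, so θ = n − ν for the matching
-- number ν: a matching yields a cover by its edges and exposed vertices, and a clique cover yields
-- a matching by keeping one edge or one vertex of each clique. As α(G − w) ≤ α(G), gap-criticality
-- forces θ(G − w) < θ(G), i.e. ν(G − w) = ν(G): every vertex is missed by some maximum matching.
-- By Gallai's lemma every component is then factor-critical.

module Submission where

open import Defs hiding (sym)
open import Data.Bool using (Bool; true; false; _∧_; not; if_then_else_) renaming (_≟_ to _≟ᵇ_)
open import Data.Bool.Properties using (∧-assoc; ∧-comm; ∧-zeroʳ; ∧-identityʳ; ∧-conicalˡ; ∧-conicalʳ)
open import Data.Empty using (⊥-elim)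
open import Data.Fin using (Fin; zero; suc; _≟_; toℕ)
open import Data.Fin.Properties using (pigeonhole; any?; all?)
open import Data.Fin.Subset using (Subset; ⊤; inside; _∈_; _∉_; _⊆_; _∩_; _∪_; _─_; _-_; ⁅_⁆; ∣_∣) renaming (⊥ to ∅)
open import Data.Fin.Subset.Properties
  using (_∈?_; _⊆?_; anySubset?; ∈⊤; ∉⊥; ∣⊥∣≡0; ∣p∣≤n; x∈⁅x⁆; x∈⁅y⁆⇒x≡y; x∈p∩q⁺; x∈p∩q⁻; x∈p∪q⁺; x∈p∪q⁻;
         p─q⊆p; x∈p∧x≢y⇒x∈p-y)
open import Data.List as List using (List; []; _∷_; length)
open import Data.List.Relation.Unary.All as All using (All; []; _∷_)
import Data.List.Relation.Unary.All.Properties as All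
open import Data.List.Relation.Unary.Any as Any using (Any; here; there)
import Data.List.Relation.Unary.Any.Properties as Any
open import Data.Nat using (ℕ; zero; suc; _+_; _*_; _∸_; _≤_; _<_; z≤n; s≤s; s≤s⁻¹)
open import Data.Nat.DivMod using (_divMod_; result)
open import Data.Nat.Properties renaming (_≟_ to _≟ℕ_)
open import Data.Nat.Solver using (module +-*-Solver)
open import Data.Product using (Σ; ∃; _×_; _,_; proj₁; proj₂)
open import Data.Sum using (_⊎_; inj₁; inj₂; [_,_]′)
open import Data.Vec using (Vec; []; _∷_; here; there; toList; fromList)
open import Data.Vec.Properties using (length-toList; toList∘fromList)
open import Function using (_∘_; const; case_of_)
open import Relation.Binary.PropositionalEquality
open import Relation.Nullary using (¬_; Dec; yes; no; does; _×-dec_; _→-dec_; ¬?)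
open import Relation.Nullary.Decidable as Dec using (dec-true; dec-false)
open import Relation.Unary using (Decidable)

open +-*-Solver using (solve; _:+_; _:*_; _:=_; con)

-- Vertex sets as Boolean predicates

witness : ∀ {A : Set} (a? : Dec A) → does a? ≡ true → A
witness (yes a) _ = a

_==_ : ∀ {n} → Fin n → Fin n → Bool
x == y = does (x ≟ y)

==-refl : ∀ {n} (x : Fin n) → (x == x) ≡ true
==-refl x = dec-true (x ≟ x) refl

==-false⇒≢ : ∀ {n} {x y : Fin n} → (x == y) ≡ false → x ≢ y
==-false⇒≢ {x = x} e refl with () ← trans (sym e) (==-refl x)

≢⇒==-false : ∀ {n} {x y : Fin n} → x ≢ y → (x == y) ≡ false
≢⇒==-false = dec-false (_ ≟ _)

_⊆ᵇ_ : ∀ {n} → (Fin n → Bool) → (Fin n → Bool) → Set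
f ⊆ᵇ g = ∀ x → f x ≡ true → g x ≡ true

∧-⊆ᵇ : ∀ {n} {U V : Fin n → Bool} (f : Fin n → Bool) → U ⊆ᵇ V → (λ x → U x ∧ f x) ⊆ᵇ (λ x → V x ∧ f x)
∧-⊆ᵇ {U = U} f U⊆V x e with U x in Ux
... | true rewrite U⊆V x Ux = e

infixl 6 _∖_

_∖_ : ∀ {n} → (Fin n → Bool) → Fin n → Fin n → Bool
(U ∖ a) x = U x ∧ not (x == a)

∖-⊆ : ∀ {n} (U : Fin n → Bool) a → (U ∖ a) ⊆ᵇ U
∖-⊆ U a x = ∧-conicalˡ (U x) _

∖-≢ : ∀ {n} (U : Fin n → Bool) {a x} → (U ∖ a) x ≡ true → x ≢ a
∖-≢ U {a} {x} e = ==-false⇒≢ (not-true (∧-conicalʳ (U x) _ e))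
  where
  not-true : ∀ {b} → not b ≡ true → b ≡ false
  not-true {false} _ = refl

∖-intro : ∀ {n} (U : Fin n → Bool) {a x} → U x ≡ true → x ≢ a → (U ∖ a) x ≡ true
∖-intro U Ux x≢a rewrite Ux | ≢⇒==-false x≢a = refl

∖-self : ∀ {n} (U : Fin n → Bool) a → (U ∖ a) a ≡ false
∖-self U a rewrite ==-refl a = ∧-zeroʳ (U a)

count : ∀ {n} → (Fin n → Bool) → ℕ
count {zero}  f = 0
count {suc n} f = (if f zero then 1 else 0) + count (λ x → f (suc x))

count-cong : ∀ {n} {f g : Fin n → Bool} → f ≗ g → count f ≡ count g
count-cong {zero}  f≗g = refl
count-cong {suc n} f≗g = cong₂ (λ b m → (if b then 1 else 0) + m) (f≗g zero) (count-cong (f≗g ∘ suc))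

count-false : ∀ {n} → count {n} (const false) ≡ 0
count-false {zero}  = refl
count-false {suc n} = count-false {n}

count-true : ∀ {n} → count {n} (const true) ≡ n
count-true {zero}  = refl
count-true {suc n} = cong suc (count-true {n})

count-split : ∀ {n} (f q : Fin n → Bool) →
  count f ≡ count (λ x → f x ∧ q x) + count (λ x → f x ∧ not (q x))
count-split {zero}  f q = refl
count-split {suc n} f q with f zero | q zero
... | true  | true  = cong suc (count-split (f ∘ suc) (q ∘ suc))
... | true  | false = trans (cong suc (count-split (f ∘ suc) (q ∘ suc))) (sym (+-suc _ _))
... | false | _     = count-split (f ∘ suc) (q ∘ suc)

count-mono : ∀ {n} {f g : Fin n → Bool} → f ⊆ᵇ g → count f ≤ count g
count-mono {zero}  f⊆g = z≤n
count-mono {suc n} {f} {g} f⊆g with f zero in f0 | g zero in g0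
... | true  | true  = s≤s (count-mono (f⊆g ∘ suc))
... | true  | false with () ← trans (sym g0) (f⊆g zero f0)
... | false | true  = m≤n⇒m≤1+n (count-mono (f⊆g ∘ suc))
... | false | false = count-mono (f⊆g ∘ suc)

count-∖ : ∀ {n} (U : Fin n → Bool) {a} → U a ≡ true → count U ≡ suc (count (U ∖ a))
count-∖ {suc n} U {zero} U0 rewrite U0 =
  cong suc (count-cong (λ x → sym (∧-identityʳ (U (suc x)))))
count-∖ {suc n} U {suc a} Ua rewrite ∧-identityʳ (U zero) =
  trans (cong ((if U zero then 1 else 0) +_) (count-∖ (U ∘ suc) Ua)) (+-suc _ _)

count-positive : ∀ {n} (f : Fin n → Bool) {a} → f a ≡ true → 0 < count f
count-positive f fa rewrite count-∖ f fa = s≤s z≤n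

x∈p-y⇒x≢y : ∀ {n} (p : Subset n) {x y} → x ∈ p - y → x ≢ y
x∈p-y⇒x≢y p {x} {y} x∈p-y refl = x∉p─q p ⁅ x ⁆ (x∈⁅x⁆ x) x∈p-y
  where
  x∉p─q : ∀ {n} (p q : Subset n) {x} → x ∈ q → x ∉ p ─ q
  x∉p─q (_ ∷ p) (inside ∷ q) here        ()
  x∉p─q (_ ∷ p) (_      ∷ q) (there x∈q) (there x∈p─q) = x∉p─q p q x∈q x∈p─q

iterate : ∀ {A : Set} → (A → A) → ℕ → A → A
iterate f zero    x = x
iterate f (suc k) x = f (iterate f k x)

iterate-+ : ∀ {A : Set} (f : A → A) a b x → iterate f (a + b) x ≡ iterate f a (iterate f b x)
iterate-+ f zero    b x = refl
iterate-+ f (suc a) b x = cong f (iterate-+ f a b x)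

iterate-* : ∀ {A : Set} (f : A → A) {a x} → iterate f a x ≡ x → ∀ c → iterate f (c * a) x ≡ x
iterate-* f         p zero    = refl
iterate-* f {a} {x} p (suc c) = trans (iterate-+ f a (c * a) x) (trans (cong (iterate f a) (iterate-* f p c)) p)

iterate-suc : ∀ {A : Set} (f : A → A) k x → iterate f (suc k) x ≡ iterate f k (f x)
iterate-suc f zero    x = refl
iterate-suc f (suc k) x = cong f (iterate-suc f k x)

iterate-inverse : ∀ {A : Set} (f g : A → A) → (∀ x → f (g x) ≡ x) → ∀ k x → iterate f k (iterate g k x) ≡ x
iterate-inverse f g f∘g zero    x = refl
iterate-inverse f g f∘g (suc k) x = begin
  iterate f (suc k) (g (iterate g k x))  ≡⟨ iterate-suc f k _ ⟩
  iterate f k (f (g (iterate g k x)))    ≡⟨ cong (iterate f k) (f∘g _) ⟩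
  iterate f k (iterate g k x)            ≡⟨ iterate-inverse f g f∘g k x ⟩
  x                                      ∎
  where open ≡-Reasoning

module Matchings {n : ℕ} (G : Graph n) where

  record Matching : Set where
    field
      mate            : Fin n → Fin n
      mate-involutive : ∀ x → mate (mate x) ≡ x
      mate-adjacent   : ∀ x → mate x ≢ x → Adj G x (mate x)

  open Matching public

  Exposed : Matching → Fin n → Set
  Exposed M x = mate M x ≡ x

  exposed : Matching → Fin n → Bool
  exposed M x = mate M x == x

  deficiency : Matching → ℕ
  deficiency M = count (exposed M)

  record IsMaximum (M : Matching) : Set where
    constructor maximum
    field
      deficiency-minimal : ∀ N → deficiency M ≤ deficiency N

  open IsMaximum public

  disagreement : Matching → Matching → ℕ
  disagreement M N = count (λ x → not (mate M x == mate N x))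

  -- For an M-closed U, the M-edges and M-exposed vertices in U form a clique cover of U with
  -- weight M U / 2 members.
  weight : Matching → (Fin n → Bool) → ℕ
  weight M U = count U + count (λ x → U x ∧ exposed M x)

  weight-all : ∀ M → weight M (const true) ≡ n + deficiency M
  weight-all M = cong (_+ deficiency M) count-true

  mate-injective : ∀ M {x y} → mate M x ≡ mate M y → x ≡ y
  mate-injective M {x} {y} e = begin
    x                   ≡⟨ mate-involutive M x ⟨
    mate M (mate M x)   ≡⟨ cong (mate M) e ⟩
    mate M (mate M y)   ≡⟨ mate-involutive M y ⟩
    y                   ∎
    where open ≡-Reasoning

  empty : Matching
  empty = record { mate = λ x → x ; mate-involutive = λ _ → refl ; mate-adjacent = λ x x≢x → ⊥-elim (x≢x refl) }

  module Augment (M : Matching) {u v} (u≢v : u ≢ v) (Mu : Exposed M u) (Mv : Exposed M v)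
                 (uv : Adj G u v) where

    mate′ : Fin n → Fin n
    mate′ x with x ≟ u | x ≟ v
    ... | yes _ | _     = v
    ... | no _  | yes _ = u
    ... | no _  | no _  = mate M x

    mate′-u : mate′ u ≡ v
    mate′-u with u ≟ u
    ... | yes _   = refl
    ... | no u≢u = ⊥-elim (u≢u refl)

    mate′-v : mate′ v ≡ u
    mate′-v with v ≟ u | v ≟ v
    ... | yes v≡u | _     = ⊥-elim (u≢v (sym v≡u))
    ... | no _    | yes _ = refl
    ... | no _    | no v≢v = ⊥-elim (v≢v refl)

    mate′-other : ∀ {x} → x ≢ u → x ≢ v → mate′ x ≡ mate M x
    mate′-other {x} x≢u x≢v with x ≟ u | x ≟ v
    ... | yes x≡u | _       = ⊥-elim (x≢u x≡u)
    ... | no _    | yes x≡v = ⊥-elim (x≢v x≡v)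
    ... | no _    | no _    = refl

    mate-avoids : ∀ {x y} → Exposed M y → x ≢ y → mate M x ≢ y
    mate-avoids My x≢y e = x≢y (mate-injective M (trans e (sym My)))

    involutive : ∀ x → mate′ (mate′ x) ≡ x
    involutive x with x ≟ u | x ≟ v
    ... | yes x≡u | _       = trans mate′-v (sym x≡u)
    ... | no _    | yes x≡v = trans mate′-u (sym x≡v)
    ... | no x≢u  | no x≢v  =
      trans (mate′-other (mate-avoids Mu x≢u) (mate-avoids Mv x≢v)) (mate-involutive M x)

    adjacent : ∀ x → mate′ x ≢ x → Adj G x (mate′ x)
    adjacent x x′≢x with x ≟ u | x ≟ v
    ... | yes refl | _        = uv
    ... | no _     | yes refl = trans (Graph.sym G v u) uv
    ... | no _     | no _     = mate-adjacent M x x′≢x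

    augment : Matching
    augment = record { mate = mate′ ; mate-involutive = involutive ; mate-adjacent = adjacent }

    exposed-augment : exposed augment ⊆ᵇ (exposed M ∖ u)
    exposed-augment x e with x ≟ u | x ≟ v
    ... | yes refl | _        with () ← trans (sym e) (≢⇒==-false (u≢v ∘ sym))
    ... | no _     | yes refl with () ← trans (sym e) (≢⇒==-false u≢v)
    ... | no _     | no _     = trans (∧-identityʳ _) e

    deficiency-augment : deficiency augment < deficiency M
    deficiency-augment = subst (deficiency augment <_) (sym (count-∖ (exposed M) (trans (cong (_== u) Mu) (==-refl u))))
                           (s≤s (count-mono exposed-augment))

    weight-augment : ∀ U → U u ≡ true → U v ≡ true → weight augment U ≤ 2 + weight M (U ∖ u ∖ v)
    weight-augment U Uu Uv = +-mono-≤ (≤-reflexive count-U) (count-mono exposed-in-U)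
      where
      count-U : count U ≡ 2 + count (U ∖ u ∖ v)
      count-U = trans (count-∖ U Uu) (cong suc (count-∖ (U ∖ u) (∖-intro U Uv (u≢v ∘ sym))))
      exposed-in-U : (λ x → U x ∧ exposed augment x) ⊆ᵇ (λ x → (U ∖ u ∖ v) x ∧ exposed M x)
      exposed-in-U x e with x ≟ u | x ≟ v
      ... | yes refl | _        with () ← trans (sym (∧-conicalʳ (U x) _ e)) (≢⇒==-false (u≢v ∘ sym))
      ... | no _     | yes refl with () ← trans (sym (∧-conicalʳ (U x) _ e)) (≢⇒==-false u≢v)
      ... | no _     | no _     rewrite ∧-identityʳ (U x) | ∧-identityʳ (U x) = e

  maximum⇒exposed-nonadjacent : ∀ {M} → IsMaximum M → ∀ {u v} → u ≢ v → Exposed M u → Exposed M v → ¬ Adj G u v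
  maximum⇒exposed-nonadjacent {M} max u≢v Mu Mv uv = <-irrefl refl (<-≤-trans deficiency-augment (deficiency-minimal max augment))
    where open Augment M u≢v Mu Mv uv

  -- Gallai's lemma

  Closed : Matching → (Fin n → Bool) → Set
  Closed M q = ∀ x → q x ≡ true → q (mate M x) ≡ true

  closed-complement : ∀ M {q} → Closed M q → ∀ x → q x ≡ false → q (mate M x) ≡ false
  closed-complement M {q} closed x qx with q (mate M x) in qMx
  ... | true  with () ← trans (sym qx) (trans (cong q (sym (mate-involutive M x))) (closed _ qMx))
  ... | false = refl

  module Splice (A B : Matching) (q : Fin n → Bool) (closedA : Closed A q) (closedB : Closed B q) where

    mate′ : Fin n → Fin n
    mate′ x = if q x then mate A x else mate B x

    involutive : ∀ x → mate′ (mate′ x) ≡ x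
    involutive x with q x in qx
    ... | true  rewrite closedA x qx = mate-involutive A x
    ... | false rewrite closed-complement B closedB x qx = mate-involutive B x

    adjacent : ∀ x → mate′ x ≢ x → Adj G x (mate′ x)
    adjacent x with q x
    ... | true  = mate-adjacent A x
    ... | false = mate-adjacent B x

    splice : Matching
    splice = record { mate = mate′ ; mate-involutive = involutive ; mate-adjacent = adjacent }

    deficiency-splice : deficiency splice ≡ count (λ x → exposed A x ∧ q x) + count (λ x → exposed B x ∧ not (q x))
    deficiency-splice = trans (count-split (exposed splice) q) (cong₂ _+_ (count-cong on-q) (count-cong off-q))
      where
      on-q : (λ x → exposed splice x ∧ q x) ≗ (λ x → exposed A x ∧ q x)
      on-q x with q x
      ... | true  = refl
      ... | false = trans (∧-zeroʳ _) (sym (∧-zeroʳ _))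
      off-q : (λ x → exposed splice x ∧ not (q x)) ≗ (λ x → exposed B x ∧ not (q x))
      off-q x with q x
      ... | true  = trans (∧-zeroʳ _) (sym (∧-zeroʳ _))
      ... | false = refl

    disagreement-splice : disagreement A splice ≡ count (λ x → not (mate A x == mate B x) ∧ not (q x))
    disagreement-splice = trans (count-split _ q) (cong₂ _+_ (trans (count-cong on-q) (count-false {n})) (count-cong off-q))
      where
      on-q : (λ x → not (mate A x == mate′ x) ∧ q x) ≗ const false
      on-q x with q x
      ... | true  rewrite ==-refl (mate A x) = refl
      ... | false = ∧-zeroʳ _
      off-q : (λ x → not (mate A x == mate′ x) ∧ not (q x)) ≗ (λ x → not (mate A x == mate B x) ∧ not (q x))
      off-q x with q x
      ... | true  = trans (∧-zeroʳ _) (sym (∧-zeroʳ _))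
      ... | false = refl

  MaximumCloser : Matching → Matching → Fin n → Set
  MaximumCloser M N z = Σ Matching λ N′ → IsMaximum N′ × Exposed N′ z × disagreement M N′ < disagreement M N

  -- Replacing N by M on a set closed under both keeps N maximum because M is maximum too.
  exchange : ∀ {M N} → IsMaximum M → IsMaximum N → ∀ {q} → Closed M q → Closed N q →
    ∀ {b} → q b ≡ true → Exposed M b → ¬ Exposed N b →
    ∀ {z} → q z ≡ false → Exposed N z → MaximumCloser M N z
  exchange {M} {N} maxM maxN {q} cM cN {b} qb Mb Nb {z} qz Nz =
    N′ , maximum′ , exposes-z , closer
    where
    module MN = Splice M N q cM cN
    module NM = Splice N M q cN cM
    N′ = MN.splice

    inM  = count (λ x → exposed M x ∧ q x)
    outM = count (λ x → exposed M x ∧ not (q x))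
    inN  = count (λ x → exposed N x ∧ q x)
    outN = count (λ x → exposed N x ∧ not (q x))

    inM≤inN : inM ≤ inN
    inM≤inN = +-cancelʳ-≤ outM inM inN (begin
      inM + outM          ≡⟨ count-split (exposed M) q ⟨
      deficiency M        ≤⟨ deficiency-minimal maxM NM.splice ⟩
      deficiency NM.splice ≡⟨ NM.deficiency-splice ⟩
      inN + outM          ∎)
      where open ≤-Reasoning

    maximum′ : IsMaximum N′
    maximum′ = maximum λ K → begin
      deficiency N′  ≡⟨ MN.deficiency-splice ⟩
      inM + outN     ≤⟨ +-monoˡ-≤ outN inM≤inN ⟩
      inN + outN     ≡⟨ count-split (exposed N) q ⟨
      deficiency N   ≤⟨ deficiency-minimal maxN K ⟩
      deficiency K   ∎
      where open ≤-Reasoning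

    exposes-z : Exposed N′ z
    exposes-z rewrite qz = Nz

    differ : Fin n → Bool
    differ x = not (mate M x == mate N x)

    differ-b : (differ b ∧ q b) ≡ true
    differ-b rewrite qb | Mb | ≢⇒==-false (Nb ∘ sym) = refl

    closer : disagreement M N′ < disagreement M N
    closer = begin-strict
      disagreement M N′                                   ≡⟨ MN.disagreement-splice ⟩
      0 + count (λ x → differ x ∧ not (q x))             <⟨ +-monoˡ-< _ (count-positive (λ x → differ x ∧ q x) differ-b) ⟩
      count (λ x → differ x ∧ q x) + count (λ x → differ x ∧ not (q x)) ≡⟨ count-split differ q ⟨
      disagreement M N                                    ∎
      where open ≤-Reasoning

  -- The orbit of b under g = M ∘ N traces the M/N-alternating path starting at b.
  module AlternatingOrbit (M N : Matching) {b} (Mb : Exposed M b) where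

    g h : Fin n → Fin n
    g x = mate M (mate N x)
    h x = mate N (mate M x)

    h∘g : ∀ x → h (g x) ≡ x
    h∘g x = trans (cong (mate N) (mate-involutive M (mate N x))) (mate-involutive N x)

    g∘h : ∀ x → g (h x) ≡ x
    g∘h x = trans (cong (mate M) (mate-involutive N (mate M x))) (mate-involutive M x)

    mate-iterate : ∀ k x → mate M (iterate g k x) ≡ iterate h k (mate M x)
    mate-iterate zero    x = refl
    mate-iterate (suc k) x = begin
      mate M (g (iterate g k x))           ≡⟨ mate-involutive M _ ⟩
      mate N (iterate g k x)                ≡⟨ cong (mate N) (mate-involutive M _) ⟨
      h (mate M (iterate g k x))            ≡⟨ cong h (mate-iterate k x) ⟩
      iterate h (suc k) (mate M x)          ∎
      where open ≡-Reasoning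

    period : ∃ λ p → iterate g (suc p) b ≡ b
    period with i , j , i<j , gⁱb≡gʲb ← pigeonhole (n<1+n n) (λ (i : Fin (suc n)) → iterate g (toℕ i) b) =
      d , (begin
        iterate g (suc d) b                                   ≡⟨ iterate-inverse h g h∘g (toℕ i) _ ⟨
        iterate h (toℕ i) (iterate g (toℕ i) (iterate g (suc d) b)) ≡⟨ cong (iterate h (toℕ i)) gⁱ⁺ᵈ⁺¹b≡gⁱb ⟩
        iterate h (toℕ i) (iterate g (toℕ i) b)               ≡⟨ iterate-inverse h g h∘g (toℕ i) b ⟩
        b                                                     ∎)
      where
      open ≡-Reasoning
      d = toℕ j ∸ suc (toℕ i)
      i+d+1≡j : toℕ i + suc d ≡ toℕ j
      i+d+1≡j = trans (+-suc (toℕ i) d) (trans (+-comm (suc (toℕ i)) d) (m∸n+n≡m i<j))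
      gⁱ⁺ᵈ⁺¹b≡gⁱb : iterate g (toℕ i) (iterate g (suc d) b) ≡ iterate g (toℕ i) b
      gⁱ⁺ᵈ⁺¹b≡gⁱb = trans (sym (iterate-+ g (toℕ i) (suc d) b))
                       (trans (cong (λ k → iterate g k b) i+d+1≡j) (sym gⁱb≡gʲb))

    p : ℕ
    p = proj₁ period

    gᵖ⁺¹b≡b : iterate g (suc p) b ≡ b
    gᵖ⁺¹b≡b = proj₂ period

    InOrbit : Fin n → Set
    InOrbit x = ∃ λ m → iterate g m b ≡ x

    inOrbit? : ∀ x → Dec (∃ λ (k : Fin (suc p)) → iterate g (toℕ k) b ≡ x)
    inOrbit? x = any? λ k → iterate g (toℕ k) b ≟ x

    inOrbit : Fin n → Bool
    inOrbit x = does (inOrbit? x)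

    inOrbit⇒InOrbit : ∀ {x} → inOrbit x ≡ true → InOrbit x
    inOrbit⇒InOrbit e with k , gᵏb≡x ← witness (inOrbit? _) e = toℕ k , gᵏb≡x

    gʳ⁺ᑫ⁽ᵖ⁺¹⁾b≡gʳb : ∀ r q → iterate g (r + q * suc p) b ≡ iterate g r b
    gʳ⁺ᑫ⁽ᵖ⁺¹⁾b≡gʳb r q = trans (iterate-+ g r (q * suc p) b) (cong (iterate g r) (iterate-* g gᵖ⁺¹b≡b q))

    InOrbit⇒inOrbit : ∀ {x} → InOrbit x → inOrbit x ≡ true
    InOrbit⇒inOrbit {x} (m , gᵐb≡x) with result q r m≡r+q*[p+1] ← m divMod suc p =
      dec-true (inOrbit? x) (r , (begin
        iterate g (toℕ r) b                ≡⟨ gʳ⁺ᑫ⁽ᵖ⁺¹⁾b≡gʳb (toℕ r) q ⟨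
        iterate g (toℕ r + q * suc p) b    ≡⟨ cong (λ k → iterate g k b) m≡r+q*[p+1] ⟨
        iterate g m b                      ≡⟨ gᵐb≡x ⟩
        x                                  ∎))
      where open ≡-Reasoning

    InOrbit-h : ∀ {x} → InOrbit x → InOrbit (h x)
    InOrbit-h (zero  , refl) = p , trans (sym (h∘g _)) (cong h gᵖ⁺¹b≡b)
    InOrbit-h (suc m , refl) = m , sym (h∘g _)

    InOrbit-hᵐ : ∀ m {x} → InOrbit x → InOrbit (iterate h m x)
    InOrbit-hᵐ zero    o = o
    InOrbit-hᵐ (suc m) o = InOrbit-h (InOrbit-hᵐ m o)

    hᵏb≡mate : ∀ k → iterate h k b ≡ mate M (iterate g k b)
    hᵏb≡mate k = trans (cong (iterate h k) (sym Mb)) (sym (mate-iterate k b))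

    InOrbit-M : ∀ {x} → InOrbit x → InOrbit (mate M x)
    InOrbit-M (m , refl) = subst InOrbit (hᵏb≡mate m) (InOrbit-hᵐ m (0 , refl))

    InOrbit-N : ∀ {x} → InOrbit x → InOrbit (mate N x)
    InOrbit-N (m , refl) = subst InOrbit (mate-involutive M _) (InOrbit-M (suc m , refl))

    closed-M : Closed M inOrbit
    closed-M x = InOrbit⇒inOrbit ∘ InOrbit-M ∘ inOrbit⇒InOrbit

    closed-N : Closed N inOrbit
    closed-N x = InOrbit⇒inOrbit ∘ InOrbit-N ∘ inOrbit⇒InOrbit

    inOrbit-b : inOrbit b ≡ true
    inOrbit-b = InOrbit⇒inOrbit (0 , refl)

    hᵃb≡gᶜb⇒gᵃ⁺ᶜb≡b : ∀ a c → iterate h a b ≡ iterate g c b → iterate g (a + c) b ≡ b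
    hᵃb≡gᶜb⇒gᵃ⁺ᶜb≡b a c e = begin
      iterate g (a + c) b                 ≡⟨ iterate-+ g a c b ⟩
      iterate g a (iterate g c b)         ≡⟨ cong (iterate g a) e ⟨
      iterate g a (iterate h a b)         ≡⟨ iterate-inverse g h g∘h a b ⟩
      b                                   ∎
      where open ≡-Reasoning

    -- An N-exposed vertex at g^j b forces g^(2j+1) b = b and an M-exposed one at g^k b forces
    -- g^(2k) b = b; as 2j+1 is odd, the latter period already returns g^k b to b.
    M-exposed-unique : ∀ {z} → InOrbit z → Exposed N z → ∀ {y} → InOrbit y → Exposed M y → y ≡ b
    M-exposed-unique (j , refl) Nz (k , refl) My = begin
      iterate g k b                           ≡⟨ cong (iterate g k) (iterate-* g g²ᵏb≡b j) ⟨
      iterate g k (iterate g (j * (k + k)) b) ≡⟨ iterate-+ g k (j * (k + k)) b ⟨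
      iterate g (k + j * (k + k)) b           ≡⟨ cong (λ m → iterate g m b) (k+j*2k≡k*[2j+1] k j) ⟩
      iterate g (k * (suc j + j)) b           ≡⟨ iterate-* g g²ʲ⁺¹b≡b k ⟩
      b                                       ∎
      where
      open ≡-Reasoning
      g²ʲ⁺¹b≡b : iterate g (suc j + j) b ≡ b
      g²ʲ⁺¹b≡b = hᵃb≡gᶜb⇒gᵃ⁺ᶜb≡b (suc j) j
        (trans (hᵏb≡mate (suc j)) (trans (mate-involutive M _) Nz))
      g²ᵏb≡b : iterate g (k + k) b ≡ b
      g²ᵏb≡b = hᵃb≡gᶜb⇒gᵃ⁺ᶜb≡b k k (trans (hᵏb≡mate k) My)
      k+j*2k≡k*[2j+1] : ∀ k j → k + j * (k + k) ≡ k * (suc j + j)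
      k+j*2k≡k*[2j+1] = solve 2 (λ k j → k :+ j :* (k :+ k) := k :* (con 1 :+ j :+ j)) refl

  adjacent⇒≢ : ∀ {u v} → Adj G u v → u ≢ v
  adjacent⇒≢ {u} uv refl with () ← trans (sym uv) (irrefl G u)

  -- N covers u and v, so the N-exposed vertex x lies outside the orbit of u or of v unless u = v.
  orbit-exchange : ∀ {u x v} → u ≢ v → ∀ {M} → IsMaximum M → Exposed M u → Exposed M v →
    ∀ {N} → IsMaximum N → Exposed N x → ¬ Exposed N u → ¬ Exposed N v → MaximumCloser M N x
  orbit-exchange {u} {x} {v} u≢v {M} maxM Mu Mv {N} maxN Nx ¬Nu ¬Nv = by-orbits _ refl _ refl
    where
    module Oᵤ = AlternatingOrbit M N Mu
    module Oᵥ = AlternatingOrbit M N Mv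
    by-orbits : ∀ a → Oᵤ.inOrbit x ≡ a → ∀ c → Oᵥ.inOrbit x ≡ c → MaximumCloser M N x
    by-orbits false x∉Oᵤ _ _ = exchange maxM maxN Oᵤ.closed-M Oᵤ.closed-N Oᵤ.inOrbit-b Mu ¬Nu x∉Oᵤ Nx
    by-orbits true  _ false x∉Oᵥ = exchange maxM maxN Oᵥ.closed-M Oᵥ.closed-N Oᵥ.inOrbit-b Mv ¬Nv x∉Oᵥ Nx
    by-orbits true  x∈Oᵤ true x∈Oᵥ with j , refl ← Oᵤ.inOrbit⇒InOrbit x∈Oᵤ =
      ⊥-elim (u≢v (Oᵥ.M-exposed-unique (Oᵥ.inOrbit⇒InOrbit x∈Oᵥ) Nx u∈Oᵥ Mu))
      where
      u∈Oᵥ : Oᵥ.InOrbit u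
      u∈Oᵥ = subst Oᵥ.InOrbit (iterate-inverse Oᵥ.h Oᵥ.g Oᵥ.h∘g j u) (Oᵥ.InOrbit-hᵐ j (Oᵥ.inOrbit⇒InOrbit x∈Oᵥ))

  exchange-step : ∀ {u x v} → Adj G u x → u ≢ v → ∀ {M} → IsMaximum M → Exposed M u → Exposed M v →
    ∀ {N} → IsMaximum N → Exposed N x → Exposed N v ⊎ MaximumCloser M N x
  exchange-step {u} {x} {v} ux u≢v maxM Mu Mv {N} maxN Nx with mate N u ≟ u | mate N v ≟ v
  ... | yes Nu | _      = ⊥-elim (maximum⇒exposed-nonadjacent maxN (adjacent⇒≢ ux) Nu Nx ux)
  ... | no _   | yes Nv = inj₁ Nv
  ... | no ¬Nu | no ¬Nv = inj₂ (orbit-exchange u≢v maxM Mu Mv maxN Nx ¬Nu ¬Nv)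

  Inessential : Fin n → Set
  Inessential w = Σ Matching λ N → IsMaximum N × Exposed N w

  module _ (inessential : ∀ w → Inessential w) where

    exposing-both : ∀ {u x v} → Adj G u x → u ≢ v → ∀ {M} → IsMaximum M → Exposed M u → Exposed M v →
      ∀ k {N} → IsMaximum N → Exposed N x → disagreement M N ≤ k →
      Σ Matching λ N′ → IsMaximum N′ × Exposed N′ x × Exposed N′ v
    exposing-both ux u≢v maxM Mu Mv k {N} maxN Nx d≤k with exchange-step ux u≢v maxM Mu Mv maxN Nx
    ... | inj₁ Nv = N , maxN , Nx , Nv
    exposing-both ux u≢v maxM Mu Mv zero    maxN Nx d≤k | inj₂ (_ , _ , _ , closer) with () ← <-≤-trans closer d≤k
    exposing-both ux u≢v maxM Mu Mv (suc k) maxN Nx d≤k | inj₂ (N′ , maxN′ , N′x , closer) =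
      exposing-both ux u≢v maxM Mu Mv k maxN′ N′x (≤-pred (<-≤-trans closer d≤k))

    -- Walk from u towards v: if the next vertex x is covered by M, a maximum matching exposing x
    -- is moved towards M until it exposes v as well.
    gallai : ∀ {C u v} → Reach G C u v → ∀ {M} → IsMaximum M → Exposed M u → Exposed M v → u ≡ v
    gallai (here _) maxM Mu Mv = refl
    gallai {u = u} {v} (step {v = x} _ ux walk) {M} maxM Mu Mv with u ≟ v
    ... | yes u≡v = u≡v
    ... | no u≢v  = ⊥-elim (maximum⇒exposed-nonadjacent maxM u≢v Mu Mv (subst (Adj G u) x≡v ux))
      where
      x≡v : x ≡ v
      x≡v with mate M x ≟ x
      ... | yes Mx = gallai walk maxM Mx Mv
      ... | no _ with N , maxN , Nx ← inessential x
                 with N′ , maxN′ , N′x , N′v ← exposing-both ux u≢v maxM Mu Mv _ maxN Nx ≤-refl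
                 = gallai walk maxN′ N′x N′v

    inessential⇒factor-critical : ∀ C → IsComponent G ⊤ C → FactorCritical G C
    inessential⇒factor-critical C (_ , _ , connected , closed) v v∈C
      with N , maxN , Nv ← inessential v = mate N , matched
      where
      matched : ∀ x → x ∈ C - v → (mate N x ∈ C - v) × Adj G x (mate N x) × (mate N (mate N x) ≡ x)
      matched x x∈C-v = x∈p∧x≢y⇒x∈p-y Nx∈C Nx≢v , x~Nx , mate-involutive N x
        where
        x∈C = p─q⊆p C ⁅ v ⁆ x∈C-v
        x≢v = x∈p-y⇒x≢y C x∈C-v
        x~Nx = mate-adjacent N x (x≢v ∘ λ Nx → gallai (connected x v x∈C v∈C) maxN Nx Nv)
        Nx∈C = closed x (mate N x) x∈C ∈⊤ x~Nx
        Nx≢v : mate N x ≢ v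
        Nx≢v Nx≡v = x≢v (trans (sym (mate-involutive N x)) (trans (cong (mate N) Nx≡v) Nv))

  -- Matchings versus clique covers

  weight-mono : ∀ M {U V} → U ⊆ᵇ V → weight M U ≤ weight M V
  weight-mono M U⊆V = +-mono-≤ (count-mono U⊆V) (count-mono (∧-⊆ᵇ (exposed M) U⊆V))

  weight-∖-exposed : ∀ M (U : Fin n → Bool) {a} → U a ≡ true → Exposed M a → weight M U ≡ 2 + weight M (U ∖ a)
  weight-∖-exposed M U {a} Ua Ma = begin
    count U + count (λ x → U x ∧ exposed M x)
      ≡⟨ cong₂ _+_ (count-∖ U Ua) (count-∖ (λ x → U x ∧ exposed M x) Ua∧Ma) ⟩
    suc (count (U ∖ a)) + suc (count (λ x → (U x ∧ exposed M x) ∧ not (x == a)))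
      ≡⟨ cong (λ m → suc (count (U ∖ a)) + suc m) (count-cong reorder) ⟩
    suc (count (U ∖ a)) + suc (count (λ x → (U ∖ a) x ∧ exposed M x))
      ≡⟨ cong suc (+-suc _ _) ⟩
    2 + weight M (U ∖ a) ∎
    where
    open ≡-Reasoning
    Ua∧Ma : (U a ∧ exposed M a) ≡ true
    Ua∧Ma rewrite Ua | Ma = ==-refl a
    reorder : (λ x → (U x ∧ exposed M x) ∧ not (x == a)) ≗ (λ x → (U ∖ a) x ∧ exposed M x)
    reorder x = trans (∧-assoc (U x) _ _) (trans (cong (U x ∧_) (∧-comm (exposed M x) _)) (sym (∧-assoc (U x) _ _)))

  weight-∖-mates : ∀ M {U : Fin n → Bool} → Closed M U → ∀ {x} → U x ≡ true →
    2 + weight M (U ∖ x ∖ mate M x) ≤ weight M U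
  weight-∖-mates M {U} closed {x} Ux with mate M x ≟ x
  ... | yes Mx = begin
    2 + weight M (U ∖ x ∖ mate M x) ≤⟨ +-monoʳ-≤ 2 (weight-mono M (∖-⊆ (U ∖ x) (mate M x))) ⟩
    2 + weight M (U ∖ x)            ≡⟨ weight-∖-exposed M U Ux Mx ⟨
    weight M U                      ∎
    where open ≤-Reasoning
  ... | no ¬Mx = begin
    2 + weight M U′
      ≤⟨ +-monoʳ-≤ 2 (+-monoʳ-≤ (count U′) (count-mono (∧-⊆ᵇ (exposed M) λ y → ∖-⊆ U x y ∘ ∖-⊆ (U ∖ x) _ y))) ⟩
    2 + (count U′ + count (λ y → U y ∧ exposed M y))
      ≡⟨ cong (_+ count (λ y → U y ∧ exposed M y)) count-U ⟨
    weight M U ∎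
    where
    open ≤-Reasoning
    U′ = U ∖ x ∖ mate M x
    count-U : count U ≡ 2 + count U′
    count-U = trans (count-∖ U Ux) (cong suc (count-∖ (U ∖ x) (∖-intro U (closed x Ux) ¬Mx)))

  Covers : (Fin n → Bool) → List (Subset n) → Set
  Covers U Ks = ∀ u → U u ≡ true → Any (u ∈_) Ks

  mates-clique : ∀ M x → IsClique G ⊤ (⁅ x ⁆ ∪ ⁅ mate M x ⁆)
  mates-clique M x = (λ _ → ∈⊤) , λ a b a∈ b∈ a≢b → adjacent (members a∈) (members b∈) a≢b
    where
    members : ∀ {a} → a ∈ ⁅ x ⁆ ∪ ⁅ mate M x ⁆ → a ≡ x ⊎ a ≡ mate M x
    members a∈ with x∈p∪q⁻ ⁅ x ⁆ ⁅ mate M x ⁆ a∈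
    ... | inj₁ a∈x  = inj₁ (x∈⁅y⁆⇒x≡y x a∈x)
    ... | inj₂ a∈Mx = inj₂ (x∈⁅y⁆⇒x≡y (mate M x) a∈Mx)
    adjacent : ∀ {a b} → a ≡ x ⊎ a ≡ mate M x → b ≡ x ⊎ b ≡ mate M x → a ≢ b → Adj G a b
    adjacent (inj₁ refl) (inj₁ refl) a≢b = ⊥-elim (a≢b refl)
    adjacent (inj₁ refl) (inj₂ refl) a≢b = mate-adjacent M x (a≢b ∘ sym)
    adjacent (inj₂ refl) (inj₁ refl) a≢b = trans (Graph.sym G _ x) (mate-adjacent M x a≢b)
    adjacent (inj₂ refl) (inj₂ refl) a≢b = ⊥-elim (a≢b refl)

  closed-∖-mates : ∀ M {U} → Closed M U → ∀ x → Closed M (U ∖ x ∖ mate M x)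
  closed-∖-mates M {U} closed x y Uy =
    ∖-intro (U ∖ x) (∖-intro U (closed y (∖-⊆ U x y (∖-⊆ (U ∖ x) _ y Uy))) My≢x) My≢Mx
    where
    My≢x : mate M y ≢ x
    My≢x My≡x = ∖-≢ (U ∖ x) Uy (trans (sym (mate-involutive M y)) (cong (mate M) My≡x))
    My≢Mx : mate M y ≢ mate M x
    My≢Mx = ∖-≢ U (∖-⊆ (U ∖ x) _ y Uy) ∘ mate-injective M

  SmallCover : Matching → (Fin n → Bool) → Set
  SmallCover M U = Σ (List (Subset n)) λ Ks → All (IsClique G ⊤) Ks × Covers U Ks × 2 * length Ks ≤ weight M U

  small-cover-∷ : ∀ M {U} → Closed M U → ∀ {x} → U x ≡ true → SmallCover M (U ∖ x ∖ mate M x) → SmallCover M U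
  small-cover-∷ M {U} closed {x} Ux (Ks , cliques , covers , bound) =
    (⁅ x ⁆ ∪ ⁅ mate M x ⁆) ∷ Ks , mates-clique M x ∷ cliques , covers′ , bound′
    where
    covers′ : Covers U (⁅ x ⁆ ∪ ⁅ mate M x ⁆ ∷ Ks)
    covers′ u Uu with u ≟ x | u ≟ mate M x
    ... | yes refl | _        = here (x∈p∪q⁺ (inj₁ (x∈⁅x⁆ x)))
    ... | no _     | yes refl = here (x∈p∪q⁺ (inj₂ (x∈⁅x⁆ (mate M x))))
    ... | no u≢x   | no u≢Mx  = there (covers u (∖-intro (U ∖ x) (∖-intro U Uu u≢x) u≢Mx))
    bound′ : 2 * suc (length Ks) ≤ weight M U
    bound′ = begin
      2 * suc (length Ks)              ≡⟨ *-suc 2 (length Ks) ⟩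
      2 + 2 * length Ks                ≤⟨ +-monoʳ-≤ 2 bound ⟩
      2 + weight M (U ∖ x ∖ mate M x)  ≤⟨ weight-∖-mates M closed Ux ⟩
      weight M U                       ∎
      where open ≤-Reasoning

  small-cover : ∀ M fuel {U} → count U ≤ fuel → Closed M U → SmallCover M U
  small-cover M fuel {U} U≤fuel closed with any? (λ a → U a ≟ᵇ true)
  ... | no U-empty = [] , [] , (λ u Uu → ⊥-elim (U-empty (u , Uu))) , z≤n
  small-cover M zero {U} U≤fuel closed | yes (x , Ux) with () ← <-≤-trans (count-positive U Ux) U≤fuel
  small-cover M (suc fuel) {U} U≤fuel closed | yes (x , Ux) =
    small-cover-∷ M closed Ux (small-cover M fuel U′≤fuel (closed-∖-mates M closed x))
    where
    U′≤fuel : count (U ∖ x ∖ mate M x) ≤ fuel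
    U′≤fuel = s≤s⁻¹ (begin-strict
      count (U ∖ x ∖ mate M x)  ≤⟨ count-mono (∖-⊆ (U ∖ x) _) ⟩
      count (U ∖ x)             <⟨ n<1+n _ ⟩
      suc (count (U ∖ x))       ≡⟨ count-∖ U Ux ⟨
      count U                   ≤⟨ U≤fuel ⟩
      suc fuel                  ∎)
      where open ≤-Reasoning

  LightMatching : (Fin n → Bool) → ℕ → Set
  LightMatching U k = Σ Matching λ N → (∀ x → U x ≡ false → Exposed N x) × weight N U ≤ 2 * k

  light-empty : ∀ {U} → U ⊆ᵇ const false → LightMatching U 0
  light-empty {U} U-empty = empty , (λ _ _ → refl) , (begin
    weight empty U                ≤⟨ weight-mono empty U-empty ⟩
    weight empty (const false)    ≡⟨ cong₂ _+_ (count-false {n}) (count-false {n}) ⟩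
    0                             ∎)
    where open ≤-Reasoning

  light-suc : ∀ {U k} → LightMatching U k → LightMatching U (suc k)
  light-suc (N , off-U , bound) = N , off-U , ≤-trans bound (*-monoʳ-≤ 2 (n≤1+n _))

  light-∖ : ∀ {U a k} → U a ≡ true → LightMatching (U ∖ a) k → LightMatching U (suc k)
  light-∖ {U} {a} {k} Ua (N , off-U , bound) = N , off-U′ , (begin
    weight N U             ≡⟨ weight-∖-exposed N U Ua Na ⟩
    2 + weight N (U ∖ a)   ≤⟨ +-monoʳ-≤ 2 bound ⟩
    2 + 2 * k              ≡⟨ *-suc 2 k ⟨
    2 * suc k              ∎)
    where
    open ≤-Reasoning
    Na : Exposed N a
    Na = off-U a (∖-self U a)
    off-U′ : ∀ x → U x ≡ false → Exposed N x
    off-U′ x Ux = off-U x (cong (_∧ not (x == a)) Ux)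

  light-∖-edge : ∀ {U a b k} → U a ≡ true → U b ≡ true → a ≢ b → Adj G a b →
    LightMatching (U ∖ a ∖ b) k → LightMatching U (suc k)
  light-∖-edge {U} {a} {b} {k} Ua Ub a≢b ab (N , off-U , bound) = augment , off-U′ , (begin
    weight augment U             ≤⟨ weight-augment U Ua Ub ⟩
    2 + weight N (U ∖ a ∖ b)     ≤⟨ +-monoʳ-≤ 2 bound ⟩
    2 + 2 * k                    ≡⟨ *-suc 2 k ⟨
    2 * suc k                    ∎)
    where
    open ≤-Reasoning
    Na : Exposed N a
    Na = off-U a (cong (_∧ not (a == b)) (∖-self U a))
    Nb : Exposed N b
    Nb = off-U b (∖-self (U ∖ a) b)
    open Augment N a≢b Na Nb ab
    off-U′ : ∀ x → U x ≡ false → Exposed augment x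
    off-U′ x Ux = trans (mate′-other (λ { refl → x∉U Ua }) (λ { refl → x∉U Ub }))
                        (off-U x (cong (λ t → (t ∧ not (x == a)) ∧ not (x == b)) Ux))
      where
      x∉U : ¬ (U x ≡ true)
      x∉U Ux′ with () ← trans (sym Ux′) Ux

  -- In a triangle-free graph a clique meets U in at most two vertices; they are joined by an
  -- edge of the matching or left exposed.
  matching-from-cover : TriangleFree G ⊤ → ∀ {W} Ks → All (IsClique G W) Ks → ∀ U → Covers U Ks →
    LightMatching U (length Ks)
  matching-from-cover tf [] [] U covers = light-empty λ u Uu → case covers u Uu of λ ()
  matching-from-cover tf (K ∷ Ks) ((_ , K-clique) ∷ cliques) U covers
    with any? (λ a → (U a ≟ᵇ true) ×-dec (a ∈? K))
  ... | no K∩U-empty = light-suc (matching-from-cover tf Ks cliques U covers′)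
    where
    covers′ : Covers U Ks
    covers′ u Uu with covers u Uu
    ... | here u∈K   = ⊥-elim (K∩U-empty (u , Uu , u∈K))
    ... | there u∈Ks = u∈Ks
  ... | yes (a , Ua , a∈K) with any? (λ b → (U b ≟ᵇ true) ×-dec ((b ∈? K) ×-dec ¬? (b ≟ a)))
  ...   | no K∩U-single = light-∖ Ua (matching-from-cover tf Ks cliques (U ∖ a) covers′)
    where
    covers′ : Covers (U ∖ a) Ks
    covers′ u Uu with covers u (∖-⊆ U a u Uu)
    ... | here u∈K   = ⊥-elim (K∩U-single (u , ∖-⊆ U a u Uu , u∈K , ∖-≢ U Uu))
    ... | there u∈Ks = u∈Ks
  ...   | yes (b , Ub , b∈K , b≢a) =
    light-∖-edge Ua Ub (b≢a ∘ sym) ab (matching-from-cover tf Ks cliques (U ∖ a ∖ b) covers′)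
    where
    ab : Adj G a b
    ab = K-clique a b a∈K b∈K (b≢a ∘ sym)
    covers′ : Covers (U ∖ a ∖ b) Ks
    covers′ u Uu with covers u (∖-⊆ U a u (∖-⊆ (U ∖ a) b u Uu))
    ... | there u∈Ks = u∈Ks
    ... | here u∈K   =
      ⊥-elim (tf a b u ∈⊤ ∈⊤ ∈⊤ (ab , K-clique b u b∈K u∈K (u≢b ∘ sym) , K-clique a u a∈K u∈K (u≢a ∘ sym)))
      where
      u≢a = ∖-≢ U (∖-⊆ (U ∖ a) b u Uu)
      u≢b = ∖-≢ (U ∖ a) Uu

-- Existence of α and θ

least : ∀ {P : ℕ → Set} → Decidable P → ∀ {m} → P m → ∃ λ k → P k × (∀ j → P j → k ≤ j)
least {P} P? {m} pm with search (suc m)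
  where
  search : ∀ i → (∃ λ k → P k × (∀ j → P j → k ≤ j)) ⊎ (∀ j → j < i → ¬ P j)
  search zero = inj₂ λ _ ()
  search (suc i) with search i
  ... | inj₁ found = inj₁ found
  ... | inj₂ none with P? i
  ...   | yes pi = inj₁ (i , pi , λ j pj → ≮⇒≥ λ j<i → none j j<i pj)
  ...   | no ¬pi = inj₂ λ j j<1+i pj → [ (λ j<i → none j j<i pj) , (λ { refl → ¬pi pj }) ]′ (m<1+n⇒m<n∨m≡n j<1+i)
... | inj₁ found = found
... | inj₂ none  = ⊥-elim (none m ≤-refl pm)

greatest : ∀ {P : ℕ → Set} → Decidable P → ∀ B → (∀ j → P j → j ≤ B) → ∃ P →
  ∃ λ k → P k × (∀ j → P j → j ≤ k)
greatest P? B bounded some with P? B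
... | yes pB = B , pB , bounded
greatest P? zero    bounded (j , pj) | no ¬pB with z≤n ← bounded j pj = ⊥-elim (¬pB pj)
greatest P? (suc B) bounded some | no ¬pB =
  greatest P? B (λ j pj → ≤-pred (≤∧≢⇒< (bounded j pj) (λ { refl → ¬pB pj }))) some

any-vector? : ∀ {A : Set} → (∀ {Q : A → Set} → Decidable Q → Dec (∃ Q)) →
  ∀ k {Q : Vec A k → Set} → Decidable Q → Dec (∃ Q)
any-vector? any-A? zero    Q? = Dec.map′ ([] ,_) (λ { ([] , q) → q }) (Q? [])
any-vector? any-A? (suc k) Q? =
  Dec.map′ (λ { (a , v , q) → a ∷ v , q }) (λ { (a ∷ v , q) → a , v , q })
           (any-A? λ a → any-vector? any-A? k (Q? ∘ (a ∷_)))

module Decisions {n : ℕ} (G : Graph n) where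

  adj? : ∀ u v → Dec (Adj G u v)
  adj? u v = adj G u v ≟ᵇ true

  clique? : ∀ W K → Dec (IsClique G W K)
  clique? W K = (K ⊆? W) ×-dec all? λ u → all? λ v → (u ∈? K) →-dec (v ∈? K) →-dec ¬? (u ≟ v) →-dec adj? u v

  stable? : ∀ W S → Dec (IsStable G W S)
  stable? W S = (S ⊆? W) ×-dec all? λ u → all? λ v → (u ∈? S) →-dec (v ∈? S) →-dec ¬? (adj? u v)

  clique-cover? : ∀ W Ks → Dec (IsCliqueCover G W Ks)
  clique-cover? W Ks = All.all? (clique? W) Ks ×-dec all? λ u → (u ∈? W) →-dec Any.any? (u ∈?_) Ks

  stable-of-size? : ∀ W k → Dec (∃ λ S → IsStable G W S × ∣ S ∣ ≡ k)
  stable-of-size? W k = anySubset? λ S → stable? W S ×-dec (∣ S ∣ ≟ℕ k)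

  empty-stable : ∀ W → ∃ λ S → IsStable G W S × ∣ S ∣ ≡ 0
  empty-stable W = ∅ , ((λ x∈⊥ → ⊥-elim (∉⊥ x∈⊥)) , λ _ _ x∈⊥ → ⊥-elim (∉⊥ x∈⊥)) , ∣⊥∣≡0 n

  singletons-cover : ∀ W → IsCliqueCover G W (List.tabulate λ u → W ∩ ⁅ u ⁆)
  singletons-cover W = All.tabulate⁺ singleton-clique , λ u u∈W → Any.tabulate⁺ u (x∈p∩q⁺ (u∈W , x∈⁅x⁆ u))
    where
    singleton-clique : ∀ u → IsClique G W (W ∩ ⁅ u ⁆)
    singleton-clique u = proj₁ ∘ x∈p∩q⁻ W ⁅ u ⁆ , λ a b a∈ b∈ a≢b → ⊥-elim (a≢b (trans (is-u a∈) (sym (is-u b∈))))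
      where
      is-u : ∀ {a} → a ∈ W ∩ ⁅ u ⁆ → a ≡ u
      is-u = x∈⁅y⁆⇒x≡y u ∘ proj₂ ∘ x∈p∩q⁻ W ⁅ u ⁆

  cover-of-length? : ∀ W k → Dec (∃ λ Ks → IsCliqueCover G W Ks × length Ks ≡ k)
  cover-of-length? W k = Dec.map′ from-vector to-vector (any-vector? anySubset? k (clique-cover? W ∘ toList))
    where
    from-vector : ∃ (IsCliqueCover G W ∘ toList) → ∃ λ Ks → IsCliqueCover G W Ks × length Ks ≡ k
    from-vector (v , cover) = toList v , cover , length-toList v
    to-vector : (∃ λ Ks → IsCliqueCover G W Ks × length Ks ≡ k) → ∃ (IsCliqueCover G W ∘ toList)
    to-vector (Ks , cover , refl) = fromList Ks , subst (IsCliqueCover G W) (sym (toList∘fromList Ks)) cover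

  alpha-exists : ∀ W → ∃ (IsAlpha G W)
  alpha-exists W
    with k , sized , maximal ← greatest (stable-of-size? W) n (λ { _ (S , _ , refl) → ∣p∣≤n S }) (0 , empty-stable W)
    = k , sized , λ S stable → maximal _ (S , stable , refl)

  theta-exists : ∀ W → ∃ (IsTheta G W)
  theta-exists W with k , sized , minimal ← least (cover-of-length? W) (_ , singletons-cover W , refl)
    = k , sized , λ Ks cover → minimal _ (Ks , cover , refl)

module _ {n : ℕ} (G : Graph n) where
  open Matchings G
  open Decisions G

  alpha-mono : ∀ {W V a b} → V ⊆ W → IsAlpha G W a → IsAlpha G V b → b ≤ a
  alpha-mono V⊆W (_ , maximal) ((S , (S⊆V , stable) , refl) , _) = maximal S ((V⊆W ∘ S⊆V) , stable)

  gap-critical⇒theta-drops : GapCritical G ⊤ → ∀ w {t t′} → IsTheta G ⊤ t → IsTheta G (⊤ - w) t′ → t′ < t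
  gap-critical⇒theta-drops gap-critical w {t} {t′} θ θ′
    with a , α ← alpha-exists ⊤ | a′ , α′ ← alpha-exists (⊤ - w) =
    +-cancelʳ-≤ a (suc t′) t (begin
      suc t′ + a     ≤⟨ gap-critical w ∈⊤ a t a′ t′ α θ α′ θ′ ⟩
      t + a′         ≤⟨ +-monoʳ-≤ t (alpha-mono (λ _ → ∈⊤) α α′) ⟩
      t + a          ∎)
    where open ≤-Reasoning

  theta-bound : ∀ {t} → IsTheta G ⊤ t → ∀ M → 2 * t ≤ n + deficiency M
  theta-bound (_ , minimal) M with Ks , cliques , covers , bound ← small-cover M n (≤-reflexive count-true) (λ _ _ → refl) =
    ≤-trans (*-monoʳ-≤ 2 (minimal Ks (cliques , λ u _ → covers u refl))) (≤-trans bound (≤-reflexive (weight-all M)))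

  -- A minimum clique cover of G - w yields a matching missing w that attains the bound above.
  theta-drop⇒inessential : TriangleFree G ⊤ → ∀ w {t t′} → IsTheta G ⊤ t → IsTheta G (⊤ - w) t′ → t′ < t →
    Inessential w
  theta-drop⇒inessential triangle-free w {t} θ ((Ks , (cliques , covers) , refl) , _) t′<t =
    inessential (matching-from-cover triangle-free Ks cliques (const true ∖ w) covers′)
    where
    covers′ : Covers (const true ∖ w) Ks
    covers′ u e = covers u (x∈p∧x≢y⇒x∈p-y ∈⊤ (∖-≢ (const true) e))
    inessential : LightMatching (const true ∖ w) (length Ks) → Inessential w
    inessential (N , off-U , bound) = N , maximum (λ K → +-cancelˡ-≤ n _ _ (≤-trans N-bound (theta-bound θ K))) , Nw
      where
      Nw : Exposed N w
      Nw = off-U w (∖-self (const true) w)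
      N-bound : n + deficiency N ≤ 2 * t
      N-bound = begin
        n + deficiency N                 ≡⟨ weight-all N ⟨
        weight N (const true)            ≡⟨ weight-∖-exposed N (const true) refl Nw ⟩
        2 + weight N (const true ∖ w)    ≤⟨ +-monoʳ-≤ 2 bound ⟩
        2 + 2 * length Ks                ≡⟨ *-suc 2 (length Ks) ⟨
        2 * suc (length Ks)              ≤⟨ *-monoʳ-≤ 2 t′<t ⟩
        2 * t                            ∎
        where open ≤-Reasoning

  triangle-free-gap-critical⇒inessential : TriangleFree G ⊤ → GapCritical G ⊤ → ∀ w → Inessential w
  triangle-free-gap-critical⇒inessential triangle-free gap-critical w
    with t , θ ← theta-exists ⊤ | t′ , θ′ ← theta-exists (⊤ - w) =
    theta-drop⇒inessential triangle-free w θ θ′ (gap-critical⇒theta-drops gap-critical w θ θ′)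

theoreml : ∀ (n : ℕ) (G : Graph n) → TriangleFree G ⊤ → GapCritical G ⊤ →
    ∀ (C : Subset n) → IsComponent G ⊤ C → FactorCritical G C
theoreml n G triangle-free gap-critical =
  Matchings.inessential⇒factor-critical G (triangle-free-gap-critical⇒inessential G triangle-free gap-critical)
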